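{- Let $G$ be a finite group of order $v$ and $J$ a subgroup of order $t$. Let $\lambda,n$ be positive integers with $n\ge 2$, $v=\frac{4n}{\lambda}+t$, $t\mid v$, $\lambda$ even if $G\setminus J$ contains an involution, and $v-t\ge 4$. Then there exists a ${}^\lambda\mathrm{NH}_t(n;2)$ over $G$ relative to $J$.
   Context: Groups are written additively (not necessarily abelian). A ${}^\lambda\mathrm{NH}_t(m,n;h,k)$ over $G$ relative to a subgroup $J$ of order $t$ is an $m\times n$ partially filled array over $G$ with exactly $h$ filled cells per row and $k$ per column, such that the multiset obtained by taking, for every filled cell with entry $x$, both $x$ and $-x$ (with multiplicity) is exactly each element of $G\setminus J$ with multiplicity $\lambda$, and such that every row sum (left to right) and every column sum (top to bottom) is nonzero. ${}^\lambda\mathrm{NH}_t(n;2)$ denotes ${}^\lambda\mathrm{NH}_t(n,n;2,2)$. -}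

module Defs where

open import Data.Nat using (ℕ; _≡ᵇ_)
open import Data.Fin using (Fin)
open import Data.Fin.Properties using (_≟_)
open import Data.Fin.Subset using (Subset; _∈_; _∉_; ∣_∣)
open import Data.Maybe using (Maybe; just; nothing)
open import Data.List using (List; []; _∷_; length; mapMaybe; concatMap; foldr; filter; allFin)
open import Data.Product using (Σ; _×_; ∃)
open import Relation.Binary.PropositionalEquality using (_≡_)
open import Relation.Nullary using (¬_)
open import Algebra.Structures using (IsGroup)

-- A finite group of order v, presented (up to isomorphism) on the carrier Fin v,
-- written additively: _+_ , 0g , -_ .
record FinGroup (v : ℕ) : Set where
  field
    _+_   : Fin v → Fin v → Fin v
    0g    : Fin v
    -_    : Fin v → Fin v
    isGroup : IsGroup _≡_ _+_ 0g -_

record IsSubgroup {v : ℕ} (G : FinGroup v) (J : Subset v) : Set where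
  open FinGroup G
  field
    0∈   : 0g ∈ J
    +∈   : ∀ {x y} → x ∈ J → y ∈ J → (x + y) ∈ J
    -∈   : ∀ {x} → x ∈ J → (- x) ∈ J

-- A partially filled m × n array over G: `nothing` is an empty cell.
PArray : ℕ → ℕ → ℕ → Set
PArray v m n = Fin m → Fin n → Maybe (Fin v)

module _ {v : ℕ} (G : FinGroup v) where
  open FinGroup G

  rowEntries : ∀ {m n} → PArray v m n → Fin m → List (Fin v)
  rowEntries A i = mapMaybe (λ j → A i j) (allFin _)

  colEntries : ∀ {m n} → PArray v m n → Fin n → List (Fin v)
  colEntries A j = mapMaybe (λ i → A i j) (allFin _)

  allEntries : ∀ {m n} → PArray v m n → List (Fin v)
  allEntries {m} A = concatMap (rowEntries A) (allFin m)

  sumG : List (Fin v) → Fin v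
  sumG = foldr _+_ 0g

  pmList : ∀ {m n} → PArray v m n → List (Fin v)
  pmList A = concatMap (λ x → x ∷ (- x) ∷ []) (allEntries A)

  -- ^λ NH_t(m,n;h,k) over G relative to J (t = ∣ J ∣ is carried by J)
  record IsNH (J : Subset v) (lam m n h k : ℕ) (A : PArray v m n) : Set where
    field
      rowFill : ∀ i → length (rowEntries A i) ≡ h
      colFill : ∀ j → length (colEntries A j) ≡ k
      mult∉J  : ∀ g → g ∉ J → length (filter (g ≟_) (pmList A)) ≡ lam
      mult∈J  : ∀ g → g ∈ J → length (filter (g ≟_) (pmList A)) ≡ 0
      rowSum≢0 : ∀ i → ¬ (sumG (rowEntries A i) ≡ 0g)
      colSum≢0 : ∀ j → ¬ (sumG (colEntries A j) ≡ 0g)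

  HasInvolutionOutside : Subset v → Set
  HasInvolutionOutside J = ∃ λ x → x ∉ J × ¬ (x ≡ 0g) × (x + x ≡ 0g)

-- Call a cyclic sequence c over G ∖ J balanced if cyclically adjacent entries never sum to 0 and
-- every g ∉ J occurs, as an entry x or as -x, exactly λ times in total. Laying such a sequence
-- a₀ b₀ a₁ b₁ … out on the cells (i, i) and (i, i + 1 mod n) gives the required array: row i holds
-- aᵢ, bᵢ and column j holds bⱼ₋₁, aⱼ, both adjacent in c. Summing the ± multiplicities over all g
-- gives 2|c| = λ(v − t) = 4n, so c fills exactly n rows.
-- A balanced sequence is built from the representatives of the pairs {x, -x} ⊆ G ∖ J (the element of
-- smaller index), followed by the representatives of the pairs with x ≠ -x, repeated λ/2 times; for
-- odd λ there are no involutions outside J and the latter representatives alone are repeated λ times.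
-- Two distinct representatives never cancel and a representative with x ≠ -x cancels none, so adjacent
-- sums are nonzero; v − t ≥ 4 keeps the first and last representative apart when G ∖ J consists of
-- involutions only.

module Submission where

open import Defs
open import Algebra.Bundles using (Group)
open import Algebra.Structures using (IsGroup)
import Algebra.Properties.Group as GroupProperties
open import Data.Bool using (if_then_else_)
open import Data.Fin using (Fin; zero; suc; toℕ; fromℕ; inject₁; lower₁)
open import Data.Fin.Permutation as Perm using (Permutation′; permutation; _⟨$⟩ʳ_; _⟨$⟩ˡ_)
open import Data.Fin.Properties
  using (_≟_; suc-injective; toℕ-injective; toℕ-fromℕ; toℕ-inject₁; toℕ-inject₁-≢; inject₁-lower₁; lower₁-inject₁′)
open import Data.Fin.Subset using (Subset; inside; outside; _∈_; _∉_; ∣_∣)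
open import Data.Fin.Subset.Properties using (_∈?_)
open import Data.List
  using (List; []; _∷_; _++_; map; concatMap; length; concat; replicate; tabulate; filter; mapMaybe; allFin; last; head)
open import Data.List.Properties using (++-identityʳ; filter-++; length-++; map-tabulate)
open import Data.List.Relation.Unary.All as All using (All; []; _∷_)
import Data.List.Relation.Unary.All.Properties as Allₚ
open import Data.List.Relation.Unary.AllPairs using (AllPairs; []; _∷_)
open import Data.List.Relation.Unary.Linked as Linked using (Linked; []; [-]; _∷_)
open import Data.List.Relation.Unary.Linked.Properties using (++⁺)
open import Data.List.Relation.Unary.Unique.Propositional using (Unique)
import Data.List.Relation.Unary.Unique.Propositional.Properties as Uniqueₚ
open import Data.Maybe using (Maybe; just; nothing)
import Data.Maybe.Relation.Unary.All as Maybe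
open import Data.Maybe.Relation.Binary.Connected using (Connected; just; just-nothing; nothing-just; nothing; drop-just)
open import Data.Nat using (ℕ; zero; suc; _+_; _*_; _∸_; _≤_; _<_; z≤n; s≤s)
import Data.Nat.Properties as ℕ
open import Data.Nat.Divisibility using (_∣_; _∣?_; divides)
open import Algebra.Properties.CommutativeSemigroup ℕ.+-commutativeSemigroup using (interchange)
open import Algebra.Properties.Semiring.Sum ℕ.+-*-semiring
  using (sum-syntax; ∑-distrib-+; ∑-permute; *-distribˡ-sum; sum-cong-≗; sum-replicate-zero)
open import Data.Product using (Σ; _×_; _,_; proj₁; proj₂)
open import Data.Sum using (_⊎_; inj₁; inj₂)
open import Data.Vec using (_∷_; [])
open import Function using (_∘_; id)
open import Level using (0ℓ)
open import Relation.Binary using (Rel; tri<; tri≈; tri>)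
open import Relation.Binary.PropositionalEquality
open import Relation.Nullary using (¬_; yes; no; does; contradiction)
open import Relation.Nullary.Decidable using (dec-true; dec-false; ¬?; _×-dec_)
open import Relation.Unary using (Pred; Decidable)

private
  variable
    A : Set

m+m≡2*n⇒m≡n : ∀ {m n} → m + m ≡ 2 * n → m ≡ n
m+m≡2*n⇒m≡n {m} {n} eq = ℕ.*-cancelˡ-≡ m n 2 (trans (cong (m +_) (ℕ.+-identityʳ m)) eq)

m+m≡4*n⇒m≡n*2 : ∀ {m n} → m + m ≡ 4 * n → m ≡ n * 2
m+m≡4*n⇒m≡n*2 {n = n} eq = m+m≡2*n⇒m≡n (trans eq (trans (ℕ.*-assoc 2 2 n) (cong (2 *_) (ℕ.*-comm 2 n))))

last-++ : ∀ (xs : List A) {y} ys → last (xs ++ y ∷ ys) ≡ last (y ∷ ys)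
last-++ []            ys = refl
last-++ (x ∷ [])      ys = refl
last-++ (x ∷ x′ ∷ xs) ys = last-++ (x′ ∷ xs) ys

CyclicallyLinked : Rel A 0ℓ → List A → Set
CyclicallyLinked R xs = Linked R xs × Connected R (last xs) (head xs)

module _ {R : Rel A 0ℓ} where

  linked-on : ∀ {P : A → Set} {S : Rel A 0ℓ} → (∀ {x y} → P x → P y → S x y → R x y) →
              ∀ {xs} → All P xs → AllPairs S xs → Linked R xs
  linked-on f []              _                = []
  linked-on f (_ ∷ [])        _                = [-]
  linked-on f (px ∷ py ∷ pxs) ((sxy ∷ _) ∷ sxs) = f px py sxy ∷ linked-on f (py ∷ pxs) sxs

  connected-last-head : ∀ {P Q : A → Set} → (∀ {x y} → P x → Q y → R x y) →
                        ∀ {xs ys} → All P xs → All Q ys → Connected R (last xs) (head ys)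
  connected-last-head f {xs} pxs qys with last xs | Allₚ.last⁺ pxs | qys
  ... | just _  | Maybe.just px | qy ∷ _ = just (f px qy)
  ... | just _  | Maybe.just _  | []     = just-nothing
  ... | nothing | Maybe.nothing | _ ∷ _  = nothing-just
  ... | nothing | Maybe.nothing | []     = nothing

  concat-replicate⁺ : ∀ {xs} → CyclicallyLinked R xs → ∀ k → CyclicallyLinked R (concat (replicate k xs))
  concat-replicate⁺ {[]}     _   zero          = [] , nothing
  concat-replicate⁺ {[]}     cyc (suc k)       = concat-replicate⁺ cyc k
  concat-replicate⁺ {x ∷ xs} _   zero          = [] , nothing
  concat-replicate⁺ {x ∷ xs} cyc (suc zero)    = subst (CyclicallyLinked R) (sym (++-identityʳ (x ∷ xs))) cyc
  concat-replicate⁺ {x ∷ xs} cyc@(lnk , wrap) (suc (suc k))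
    with lnk′ , wrap′ ← concat-replicate⁺ cyc (suc k) =
    ++⁺ lnk wrap lnk′ , subst (λ z → Connected R z (just x)) (sym (last-++ (x ∷ xs) _)) wrap′

prev : ∀ {m} → Fin (suc m) → Fin (suc m)
prev {m} zero    = fromℕ m
prev     (suc i) = inject₁ i

next : ∀ {m} → Fin (suc m) → Fin (suc m)
next {m} i with m ℕ.≟ toℕ i
... | yes _   = zero
... | no  m≢i = suc (lower₁ i m≢i)

prev-next : ∀ {m} (i : Fin (suc m)) → prev (next i) ≡ i
prev-next {m} i with m ℕ.≟ toℕ i
... | yes m≡i = toℕ-injective (trans (toℕ-fromℕ m) m≡i)
... | no  m≢i = inject₁-lower₁ i m≢i

next-prev : ∀ {m} (j : Fin (suc m)) → next (prev j) ≡ j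
next-prev {m} zero with m ℕ.≟ toℕ (fromℕ m)
... | yes _   = refl
... | no  m≢m = contradiction (sym (toℕ-fromℕ m)) m≢m
next-prev {m} (suc i) with m ℕ.≟ toℕ (inject₁ i)
... | yes m≡i = contradiction m≡i (toℕ-inject₁-≢ i)
... | no  m≢i = cong suc (lower₁-inject₁′ i m≢i)

prev-≢ : ∀ {m} (j : Fin (suc (suc m))) → prev j ≢ j
prev-≢ zero    ()
prev-≢ (suc i) eq = ℕ.1+n≢n (trans (sym (cong toℕ eq)) (toℕ-inject₁ i))

rotation : ∀ {m} → Permutation′ (suc m)
rotation = permutation next prev next-prev prev-next

rotation-≢ : ∀ {m} (i : Fin (suc (suc m))) → rotation ⟨$⟩ʳ i ≢ i
rotation-≢ i eq = prev-≢ i (trans (cong prev (sym eq)) (prev-next i))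

pairUp : ∀ {m} (c : List A) → length c ≡ suc m * 2 → Fin (suc m) → A × A
pairUp         (x ∷ y ∷ c) _  zero    = x , y
pairUp {m = suc m} (x ∷ y ∷ c) eq (suc i) = pairUp c (ℕ.suc-injective (ℕ.suc-injective eq)) i

pairList : A × A → List A
pairList (x , y) = x ∷ y ∷ []

concat-pairUp : ∀ {m} (c : List A) (eq : length c ≡ suc m * 2) →
                concat (tabulate (pairList ∘ pairUp {m = m} c eq)) ≡ c
concat-pairUp {m = zero}  (x ∷ y ∷ []) _  = refl
concat-pairUp {m = suc m} (x ∷ y ∷ c)  eq = cong (λ c′ → x ∷ y ∷ c′) (concat-pairUp {m = m} c _)

last-pairUp : ∀ {m} (c : List A) (eq : length c ≡ suc m * 2) →
              last c ≡ just (proj₂ (pairUp c eq (fromℕ m)))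
last-pairUp {m = zero}  (x ∷ y ∷ [])     _  = refl
last-pairUp {m = suc m} (x ∷ y ∷ c@(_ ∷ _ ∷ _)) eq = last-pairUp {m = m} c _

module _ {R : Rel A 0ℓ} where

  pairUp-linked : ∀ {m} (c : List A) (eq : length c ≡ suc m * 2) → Linked R c →
                  ∀ (i : Fin (suc m)) → R (proj₁ (pairUp c eq i)) (proj₂ (pairUp c eq i))
  pairUp-linked         (x ∷ y ∷ c) eq (rxy ∷ _) zero    = rxy
  pairUp-linked {m = suc m} (x ∷ y ∷ c) eq lnk       (suc i) =
    pairUp-linked {m = m} c _ (Linked.tail (Linked.tail lnk)) i

  pairUp-linked-inject₁ : ∀ {m} (c : List A) (eq : length c ≡ suc m * 2) → Linked R c →
                          ∀ (i : Fin m) → R (proj₂ (pairUp c eq (inject₁ i))) (proj₁ (pairUp c eq (suc i)))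
  pairUp-linked-inject₁ {m = suc m} (x ∷ y ∷ c@(_ ∷ _ ∷ _)) eq (_ ∷ ryz ∷ _) zero = ryz
  pairUp-linked-inject₁ {m = suc m} (x ∷ y ∷ c@(_ ∷ _ ∷ _)) eq lnk (suc i) =
    pairUp-linked-inject₁ {m = m} c _ (Linked.tail (Linked.tail lnk)) i

  pairUp-cyclic : ∀ {m} (c : List A) (eq : length c ≡ suc m * 2) → CyclicallyLinked R c →
                  ∀ (j : Fin (suc m)) → R (proj₂ (pairUp c eq (prev j))) (proj₁ (pairUp c eq j))
  pairUp-cyclic {m} c@(x ∷ y ∷ _) eq (_ , wrap) zero =
    drop-just (subst (λ z → Connected R z (just x)) (last-pairUp {m = m} c eq) wrap)
  pairUp-cyclic c eq (lnk , _) (suc i) = pairUp-linked-inject₁ c eq lnk i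

-- Arrays with two filled diagonals

ListsPair : A → A → List A → Set
ListsPair x y xs = xs ≡ x ∷ y ∷ [] ⊎ xs ≡ y ∷ x ∷ []

ListsPair-length : ∀ {x y : A} {xs} → ListsPair x y xs → length xs ≡ 2
ListsPair-length (inj₁ refl) = refl
ListsPair-length (inj₂ refl) = refl

module _ {B : Set} (f : B → Maybe A) where

  mapMaybe-tabulate-none : ∀ {n} (h : Fin n → B) → (∀ r → f (h r) ≡ nothing) →
                           mapMaybe f (tabulate h) ≡ []
  mapMaybe-tabulate-none {zero}  h none = refl
  mapMaybe-tabulate-none {suc n} h none rewrite none zero =
    mapMaybe-tabulate-none (h ∘ suc) (none ∘ suc)

  mapMaybe-tabulate-one : ∀ {n} (h : Fin n → B) {p x} → f (h p) ≡ just x →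
                          (∀ r → r ≢ p → f (h r) ≡ nothing) →
                          mapMaybe f (tabulate h) ≡ x ∷ []
  mapMaybe-tabulate-one {suc n} h {zero} hp none rewrite hp =
    cong (_ ∷_) (mapMaybe-tabulate-none (h ∘ suc) (λ r → none (suc r) λ ()))
  mapMaybe-tabulate-one {suc n} h {suc p} hp none rewrite none zero (λ ()) =
    mapMaybe-tabulate-one (h ∘ suc) hp (λ r r≢p → none (suc r) (r≢p ∘ suc-injective))

  mapMaybe-tabulate-two : ∀ {n} (h : Fin n → B) {p q x y} → p ≢ q →
                          f (h p) ≡ just x → f (h q) ≡ just y →
                          (∀ r → r ≢ p → r ≢ q → f (h r) ≡ nothing) →
                          ListsPair x y (mapMaybe f (tabulate h))
  mapMaybe-tabulate-two {suc n} h {zero}  {zero}  p≢q _  _  _ = contradiction refl p≢q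
  mapMaybe-tabulate-two {suc n} h {zero}  {suc q} _   hp hq none rewrite hp =
    inj₁ (cong (_ ∷_) (mapMaybe-tabulate-one (h ∘ suc) hq
      (λ r r≢q → none (suc r) (λ ()) (r≢q ∘ suc-injective))))
  mapMaybe-tabulate-two {suc n} h {suc p} {zero}  _   hp hq none rewrite hq =
    inj₂ (cong (_ ∷_) (mapMaybe-tabulate-one (h ∘ suc) hp
      (λ r r≢p → none (suc r) (r≢p ∘ suc-injective) (λ ()))))
  mapMaybe-tabulate-two {suc n} h {suc p} {suc q} p≢q hp hq none rewrite none zero (λ ()) (λ ()) =
    mapMaybe-tabulate-two (h ∘ suc) (p≢q ∘ cong suc) hp hq
      (λ r r≢p r≢q → none (suc r) (r≢p ∘ suc-injective) (r≢q ∘ suc-injective))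

module _ {n} (σ : Permutation′ n) (a b : Fin n → A) where

  twoDiagonals : Fin n → Fin n → Maybe A
  twoDiagonals i j = if does (j ≟ i) then just (a i) else if does (j ≟ σ ⟨$⟩ʳ i) then just (b i) else nothing

  module _ (σ-≢ : ∀ i → σ ⟨$⟩ʳ i ≢ i) where

    twoDiagonals-diag : ∀ i → twoDiagonals i i ≡ just (a i)
    twoDiagonals-diag i rewrite dec-true (i ≟ i) refl = refl

    twoDiagonals-σ : ∀ i → twoDiagonals i (σ ⟨$⟩ʳ i) ≡ just (b i)
    twoDiagonals-σ i rewrite dec-false (σ ⟨$⟩ʳ i ≟ i) (σ-≢ i) | dec-true (σ ⟨$⟩ʳ i ≟ σ ⟨$⟩ʳ i) refl = refl

    twoDiagonals-empty : ∀ {i j} → j ≢ i → j ≢ σ ⟨$⟩ʳ i → twoDiagonals i j ≡ nothing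
    twoDiagonals-empty {i} {j} j≢i j≢σi rewrite dec-false (j ≟ i) j≢i | dec-false (j ≟ σ ⟨$⟩ʳ i) j≢σi = refl

    twoDiagonals-row : ∀ i → ListsPair (a i) (b i) (mapMaybe (twoDiagonals i) (allFin n))
    twoDiagonals-row i = mapMaybe-tabulate-two (twoDiagonals i) id (≢-sym (σ-≢ i))
      (twoDiagonals-diag i) (twoDiagonals-σ i) (λ _ → twoDiagonals-empty)

    twoDiagonals-column : ∀ j → ListsPair (a j) (b (σ ⟨$⟩ˡ j)) (mapMaybe (λ i → twoDiagonals i j) (allFin n))
    twoDiagonals-column j = mapMaybe-tabulate-two (λ i → twoDiagonals i j) id j≢σ⁻¹j
      (twoDiagonals-diag j) σ⁻¹j-cell (λ i i≢j i≢σ⁻¹j → twoDiagonals-empty (≢-sym i≢j) (i≢σ⁻¹j ∘ σ⁻¹-from))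
      where
      σσ⁻¹j≡j : σ ⟨$⟩ʳ (σ ⟨$⟩ˡ j) ≡ j
      σσ⁻¹j≡j = Perm.inverseʳ σ
      j≢σ⁻¹j : j ≢ σ ⟨$⟩ˡ j
      j≢σ⁻¹j j≡ = σ-≢ (σ ⟨$⟩ˡ j) (trans σσ⁻¹j≡j j≡)
      σ⁻¹j-cell : twoDiagonals (σ ⟨$⟩ˡ j) j ≡ just (b (σ ⟨$⟩ˡ j))
      σ⁻¹j-cell = subst (λ k → twoDiagonals (σ ⟨$⟩ˡ j) k ≡ just (b (σ ⟨$⟩ˡ j))) σσ⁻¹j≡j (twoDiagonals-σ (σ ⟨$⟩ˡ j))
      σ⁻¹-from : ∀ {i} → j ≡ σ ⟨$⟩ʳ i → i ≡ σ ⟨$⟩ˡ j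
      σ⁻¹-from {i} j≡σi = trans (sym (Perm.inverseˡ σ)) (cong (σ ⟨$⟩ˡ_) (sym j≡σi))

-- Multiplicities

count : ∀ {v} → Fin v → List (Fin v) → ℕ
count g xs = length (filter (g ≟_) xs)

module _ {v} (g : Fin v) where

  count-++ : ∀ xs ys → count g (xs ++ ys) ≡ count g xs + count g ys
  count-++ xs ys = trans (cong length (filter-++ (g ≟_) xs ys)) (length-++ (filter (g ≟_) xs))

  count-∷ : ∀ x xs → count g (x ∷ xs) ≡ count g (x ∷ []) + count g xs
  count-∷ x = count-++ (x ∷ [])

  count-concat-replicate : ∀ k xs → count g (concat (replicate k xs)) ≡ k * count g xs
  count-concat-replicate zero    xs = refl
  count-concat-replicate (suc k) xs =
    trans (count-++ xs _) (cong (count g xs +_) (count-concat-replicate k xs))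

  count-concat-tabulate : ∀ {n} (f f′ : Fin n → List (Fin v)) → (∀ i → count g (f i) ≡ count g (f′ i)) →
                          count g (concat (tabulate f)) ≡ count g (concat (tabulate f′))
  count-concat-tabulate {zero}  f f′ eq = refl
  count-concat-tabulate {suc n} f f′ eq = begin
    count g (f zero ++ concat (tabulate (f ∘ suc)))                ≡⟨ count-++ (f zero) _ ⟩
    count g (f zero) + count g (concat (tabulate (f ∘ suc)))       ≡⟨ cong₂ _+_ (eq zero) (count-concat-tabulate (f ∘ suc) (f′ ∘ suc) (eq ∘ suc)) ⟩
    count g (f′ zero) + count g (concat (tabulate (f′ ∘ suc)))     ≡⟨ count-++ (f′ zero) _ ⟨
    count g (f′ zero ++ concat (tabulate (f′ ∘ suc)))              ∎
    where open ≡-Reasoning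

  count-ListsPair : ∀ {x y xs} → ListsPair x y xs → count g xs ≡ count g (x ∷ y ∷ [])
  count-ListsPair (inj₁ refl) = refl
  count-ListsPair {x} {y} (inj₂ refl) = begin
    count g (y ∷ x ∷ [])                   ≡⟨ count-∷ y (x ∷ []) ⟩
    count g (y ∷ []) + count g (x ∷ [])    ≡⟨ ℕ.+-comm (count g (y ∷ [])) _ ⟩
    count g (x ∷ []) + count g (y ∷ [])    ≡⟨ count-∷ x (y ∷ []) ⟨
    count g (x ∷ y ∷ [])                   ∎
    where open ≡-Reasoning

  module _ {P : Pred (Fin v) 0ℓ} (P? : Decidable P) where

    count-filter-accept : P g → ∀ xs → count g (filter P? xs) ≡ count g xs
    count-filter-accept pg []       = refl
    count-filter-accept pg (x ∷ xs) with P? x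
    ... | yes _ = trans (count-∷ x _) (trans (cong (count g (x ∷ []) +_) (count-filter-accept pg xs)) (sym (count-∷ x xs)))
    ... | no ¬px with g ≟ x
    ...   | yes refl = contradiction pg ¬px
    ...   | no  _    = count-filter-accept pg xs

    count-filter-reject : ¬ P g → ∀ xs → count g (filter P? xs) ≡ 0
    count-filter-reject ¬pg []       = refl
    count-filter-reject ¬pg (x ∷ xs) with P? x
    ... | no _ = count-filter-reject ¬pg xs
    ... | yes px with g ≟ x
    ...   | yes refl = contradiction px ¬pg
    ...   | no  _    = count-filter-reject ¬pg xs

count-singleton-sym : ∀ {v} (g x : Fin v) → count g (x ∷ []) ≡ count x (g ∷ [])
count-singleton-sym g x with g ≟ x | x ≟ g
... | yes _   | yes _   = refl
... | no  _   | no  _   = refl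
... | yes g≡x | no  x≢g = contradiction (sym g≡x) x≢g
... | no  g≢x | yes x≡g = contradiction (sym x≡g) g≢x

count-suc-singleton : ∀ {v} (g x : Fin v) → count (suc g) (suc x ∷ []) ≡ count g (x ∷ [])
count-suc-singleton g x with g ≟ x
... | yes _ = refl
... | no  _ = refl

∑-count-singleton : ∀ {v} (x : Fin v) → ∑[ g < v ] count g (x ∷ []) ≡ 1
∑-count-singleton {suc v} zero    = cong suc (sum-replicate-zero v)
∑-count-singleton {suc v} (suc x) = trans (sum-cong-≗ (λ g → count-suc-singleton g x)) (∑-count-singleton x)

∑-count : ∀ {v} (xs : List (Fin v)) → ∑[ g < v ] count g xs ≡ length xs
∑-count {v} []       = sum-replicate-zero v
∑-count {v} (x ∷ xs) = begin
  ∑[ g < v ] count g (x ∷ xs)                                   ≡⟨ sum-cong-≗ (λ g → count-∷ g x xs) ⟩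
  ∑[ g < v ] (count g (x ∷ []) + count g xs)                    ≡⟨ ∑-distrib-+ (λ g → count g (x ∷ [])) _ ⟩
  ∑[ g < v ] count g (x ∷ []) + ∑[ g < v ] count g xs           ≡⟨ cong₂ _+_ (∑-count-singleton x) (∑-count xs) ⟩
  suc (length xs)                                               ∎
  where open ≡-Reasoning

count-tabulate : ∀ {v n} (g : Fin v) (h : Fin n → Fin v) → count g (tabulate h) ≡ ∑[ i < n ] count g (h i ∷ [])
count-tabulate {n = zero}  g h = refl
count-tabulate {n = suc n} g h = trans (count-∷ g (h zero) _) (cong (count g (h zero ∷ []) +_) (count-tabulate g (h ∘ suc)))

count-allFin : ∀ {v} (g : Fin v) → count g (allFin v) ≡ 1
count-allFin {v} g = begin
  count g (allFin v)                ≡⟨ count-tabulate g id ⟩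
  ∑[ i < v ] count g (i ∷ [])       ≡⟨ sum-cong-≗ (count-singleton-sym g) ⟩
  ∑[ i < v ] count i (g ∷ [])       ≡⟨ ∑-count-singleton g ⟩
  1                                 ∎
  where open ≡-Reasoning

count-filter-allFin-accept : ∀ {v} {P : Pred (Fin v) 0ℓ} (P? : Decidable P) {g} → P g →
                             count g (filter P? (allFin v)) ≡ 1
count-filter-allFin-accept P? {g} pg = trans (count-filter-accept g P? pg (allFin _)) (count-allFin g)

𝟙∁ : ∀ {v} → Subset v → Fin v → ℕ
𝟙∁ J g = if does (g ∈? J) then 0 else 1

𝟙∁-∈ : ∀ {v} {J : Subset v} {g} → g ∈ J → 𝟙∁ J g ≡ 0
𝟙∁-∈ {J = J} {g} g∈J rewrite dec-true (g ∈? J) g∈J = refl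

𝟙∁-∉ : ∀ {v} {J : Subset v} {g} → g ∉ J → 𝟙∁ J g ≡ 1
𝟙∁-∉ {J = J} {g} g∉J rewrite dec-false (g ∈? J) g∉J = refl

∑-𝟙∁+∣J∣ : ∀ {v} (J : Subset v) → ∑[ g < v ] 𝟙∁ J g + ∣ J ∣ ≡ v
∑-𝟙∁+∣J∣ []           = refl
∑-𝟙∁+∣J∣ (inside ∷ J)  = trans (ℕ.+-suc _ ∣ J ∣) (cong suc (∑-𝟙∁+∣J∣ J))
∑-𝟙∁+∣J∣ (outside ∷ J) = cong suc (∑-𝟙∁+∣J∣ J)

∑-𝟙∁ : ∀ {v} (J : Subset v) → ∑[ g < v ] 𝟙∁ J g ≡ v ∸ ∣ J ∣
∑-𝟙∁ J = trans (sym (ℕ.m+n∸n≡m _ ∣ J ∣)) (cong (_∸ ∣ J ∣) (∑-𝟙∁+∣J∣ J))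

-- Balanced cycles in a finite group

module WithGroup {v} (G : FinGroup v) where

  open FinGroup G renaming (_+_ to _⊕_; -_ to ⊖_)
  open IsGroup isGroup using (inverseˡ; inverseʳ; identityʳ)

  private
    group : Group 0ℓ 0ℓ
    group = record { isGroup = isGroup }

  open GroupProperties group using (⁻¹-involutive; inverseʳ-unique)

  NonCancelling : Rel (Fin v) 0ℓ
  NonCancelling x y = x ⊕ y ≢ 0g

  nonCancelling-sym : ∀ {x y} → NonCancelling x y → NonCancelling y x
  nonCancelling-sym {x} {y} x⊕y≢0 y⊕x≡0 =
    x⊕y≢0 (trans (cong (_⊕ y) (inverseʳ-unique y x y⊕x≡0)) (inverseˡ y))

  sumG-ListsPair≢0 : ∀ {x y xs} → NonCancelling x y → ListsPair x y xs → sumG G xs ≢ 0g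
  sumG-ListsPair≢0 {x} {y} nc (inj₁ refl) = nc ∘ trans (cong (x ⊕_) (sym (identityʳ y)))
  sumG-ListsPair≢0 {x} {y} nc (inj₂ refl) = nonCancelling-sym nc ∘ trans (cong (y ⊕_) (sym (identityʳ x)))

  count± : Fin v → List (Fin v) → ℕ
  count± g xs = count g xs + count (⊖ g) xs

  count-⊖-singleton : ∀ g x → count g (⊖ x ∷ []) ≡ count (⊖ g) (x ∷ [])
  count-⊖-singleton g x with g ≟ ⊖ x | ⊖ g ≟ x
  ... | yes _   | yes _   = refl
  ... | no  _   | no  _   = refl
  ... | yes g≡⊖x | no ⊖g≢x = contradiction (trans (cong ⊖_ g≡⊖x) (⁻¹-involutive x)) ⊖g≢x
  ... | no g≢⊖x | yes ⊖g≡x = contradiction (trans (sym (⁻¹-involutive g)) (cong ⊖_ ⊖g≡x)) g≢⊖x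

  count±-++ : ∀ g xs ys → count± g (xs ++ ys) ≡ count± g xs + count± g ys
  count±-++ g xs ys = trans (cong₂ _+_ (count-++ g xs ys) (count-++ (⊖ g) xs ys))
                            (interchange (count g xs) _ _ _)

  count±-concat-replicate : ∀ g k xs → count± g (concat (replicate k xs)) ≡ k * count± g xs
  count±-concat-replicate g k xs =
    trans (cong₂ _+_ (count-concat-replicate g k xs) (count-concat-replicate (⊖ g) k xs))
          (sym (ℕ.*-distribˡ-+ k (count g xs) _))

  count±-⊖ : ∀ g xs → count± (⊖ g) xs ≡ count± g xs
  count±-⊖ g xs = trans (cong (count (⊖ g) xs +_) (cong (λ h → count h xs) (⁻¹-involutive g)))
                        (ℕ.+-comm (count (⊖ g) xs) _)

  count-concatMap-± : ∀ g xs → count g (concatMap (λ x → x ∷ ⊖ x ∷ []) xs) ≡ count± g xs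
  count-concatMap-± g []       = refl
  count-concatMap-± g (x ∷ xs) = begin
    count g ((x ∷ ⊖ x ∷ []) ++ concatMap (λ x → x ∷ ⊖ x ∷ []) xs)
      ≡⟨ count-++ g (x ∷ ⊖ x ∷ []) _ ⟩
    count g (x ∷ ⊖ x ∷ []) + count g (concatMap (λ x → x ∷ ⊖ x ∷ []) xs)
      ≡⟨ cong₂ _+_ (trans (count-∷ g x _) (cong (count g (x ∷ []) +_) (count-⊖-singleton g x)))
                   (count-concatMap-± g xs) ⟩
    count± g (x ∷ []) + count± g xs
      ≡⟨ count±-++ g (x ∷ []) xs ⟨
    count± g (x ∷ xs) ∎
    where open ≡-Reasoning

  negation : Permutation′ v
  negation = permutation ⊖_ ⊖_ ⁻¹-involutive ⁻¹-involutive

  ∑-count± : ∀ xs → ∑[ g < v ] count± g xs ≡ length xs + length xs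
  ∑-count± xs = begin
    ∑[ g < v ] count± g xs                                ≡⟨ ∑-distrib-+ (λ g → count g xs) _ ⟩
    ∑[ g < v ] count g xs + ∑[ g < v ] count (⊖ g) xs     ≡⟨ cong (_ +_) (∑-permute (λ g → count g xs) negation) ⟨
    ∑[ g < v ] count g xs + ∑[ g < v ] count g xs         ≡⟨ cong₂ _+_ (∑-count xs) (∑-count xs) ⟩
    length xs + length xs                                 ∎
    where open ≡-Reasoning

  length-by-count± : ∀ (J : Subset v) k xs → (∀ g → count± g xs ≡ k * 𝟙∁ J g) →
                     length xs + length xs ≡ k * (v ∸ ∣ J ∣)
  length-by-count± J k xs eq = begin
    length xs + length xs        ≡⟨ ∑-count± xs ⟨
    ∑[ g < v ] count± g xs       ≡⟨ sum-cong-≗ eq ⟩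
    ∑[ g < v ] (k * 𝟙∁ J g)      ≡⟨ *-distribˡ-sum k (𝟙∁ J) ⟨
    k * (∑[ g < v ] 𝟙∁ J g)      ≡⟨ cong (k *_) (∑-𝟙∁ J) ⟩
    k * (v ∸ ∣ J ∣)              ∎
    where open ≡-Reasoning

  module Representatives (J : Subset v) (J≤G : IsSubgroup G J) where

    open IsSubgroup J≤G using (-∈)

    ⊖-∉ : ∀ {x} → x ∉ J → ⊖ x ∉ J
    ⊖-∉ {x} x∉J ⊖x∈J = x∉J (subst (_∈ J) (⁻¹-involutive x) (-∈ ⊖x∈J))

    Rep StrictRep : Pred (Fin v) 0ℓ
    Rep       x = x ∉ J × toℕ x ≤ toℕ (⊖ x)
    StrictRep x = x ∉ J × toℕ x < toℕ (⊖ x)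

    rep? : Decidable Rep
    rep? x = ¬? (x ∈? J) ×-dec (toℕ x ℕ.≤? toℕ (⊖ x))

    strictRep? : Decidable StrictRep
    strictRep? x = ¬? (x ∈? J) ×-dec (toℕ x ℕ.<? toℕ (⊖ x))

    reps strictReps : List (Fin v)
    reps       = filter rep? (allFin v)
    strictReps = filter strictRep? (allFin v)

    strictRep⇒rep : ∀ {x} → StrictRep x → Rep x
    strictRep⇒rep (x∉J , x<⊖x) = x∉J , ℕ.<⇒≤ x<⊖x

    cancelling-reps : ∀ {x y} → Rep x → Rep y → x ⊕ y ≡ 0g → x ≡ y
    cancelling-reps {x} {y} (_ , x≤⊖x) (_ , y≤⊖y) x⊕y≡0 =
      toℕ-injective (ℕ.≤-antisym (subst (λ z → toℕ x ≤ toℕ z) (sym y≡⊖x) x≤⊖x)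
                                 (subst (λ z → toℕ y ≤ toℕ z) ⊖y≡x y≤⊖y))
      where
      y≡⊖x : y ≡ ⊖ x
      y≡⊖x = inverseʳ-unique x y x⊕y≡0
      ⊖y≡x : ⊖ y ≡ x
      ⊖y≡x = trans (cong ⊖_ y≡⊖x) (⁻¹-involutive x)

    nonCancelling-reps : ∀ {x y} → Rep x → Rep y → x ≢ y → NonCancelling x y
    nonCancelling-reps rx ry x≢y = x≢y ∘ cancelling-reps rx ry

    nonCancelling-strictRep-rep : ∀ {x y} → StrictRep x → Rep y → NonCancelling x y
    nonCancelling-strictRep-rep {x} {y} sx@(_ , x<⊖x) ry x⊕y≡0 =
      ℕ.<-irrefl (cong toℕ (trans x≡y (inverseʳ-unique x y x⊕y≡0))) x<⊖x
      where
      x≡y : x ≡ y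
      x≡y = cancelling-reps (strictRep⇒rep sx) ry x⊕y≡0

    ¬rep-⊖ : ∀ {g} → toℕ g < toℕ (⊖ g) → ¬ Rep (⊖ g)
    ¬rep-⊖ {g} g<⊖g (_ , ⊖g≤⊖⊖g) = ℕ.<⇒≱ g<⊖g (subst (λ z → toℕ (⊖ g) ≤ toℕ z) (⁻¹-involutive g) ⊖g≤⊖⊖g)

    count±-∈ : ∀ {g} → g ∈ J → count± g reps ≡ 0 × count± g strictReps ≡ 0
    count±-∈ {g} g∈J = cong₂ _+_ (absent rep? g∈J) (absent rep? (-∈ g∈J)) ,
                       cong₂ _+_ (absent strictRep? g∈J) (absent strictRep? (-∈ g∈J))
      where
      absent : ∀ {Q : Pred (Fin v) 0ℓ} (P? : Decidable (λ x → x ∉ J × Q x)) {x} → x ∈ J →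
               count x (filter P? (allFin v)) ≡ 0
      absent P? x∈J = count-filter-reject _ P? (λ (x∉J , _) → x∉J x∈J) (allFin v)

    count±-strictRep : ∀ {g} → StrictRep g → count± g reps ≡ 1 × count± g strictReps ≡ 1
    count±-strictRep {g} sg@(_ , g<⊖g) =
      cong₂ _+_ (count-filter-allFin-accept rep? (strictRep⇒rep sg))
                (count-filter-reject _ rep? (¬rep-⊖ g<⊖g) (allFin v)) ,
      cong₂ _+_ (count-filter-allFin-accept strictRep? sg)
                (count-filter-reject _ strictRep? (¬rep-⊖ g<⊖g ∘ strictRep⇒rep) (allFin v))

    count±-selfInverse : ∀ {g} → g ∉ J → toℕ g ≡ toℕ (⊖ g) → count± g reps ≡ 2 × count± g strictReps ≡ 0
    count±-selfInverse {g} g∉J g≡⊖g =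
      cong₂ _+_ (count-filter-allFin-accept rep? (g∉J , ℕ.≤-reflexive g≡⊖g))
                (count-filter-allFin-accept rep? (⊖-∉ g∉J , ℕ.≤-reflexive ⊖g≡⊖⊖g)) ,
      cong₂ _+_ (count-filter-reject _ strictRep? (ℕ.<-irrefl g≡⊖g ∘ proj₂) (allFin v))
                (count-filter-reject _ strictRep? (ℕ.<-irrefl ⊖g≡⊖⊖g ∘ proj₂) (allFin v))
      where
      ⊖g≡⊖⊖g : toℕ (⊖ g) ≡ toℕ (⊖ (⊖ g))
      ⊖g≡⊖⊖g = trans (sym g≡⊖g) (cong toℕ (sym (⁻¹-involutive g)))

    classify : ∀ g → g ∈ J ⊎ g ∉ J × (StrictRep g ⊎ StrictRep (⊖ g) ⊎ toℕ g ≡ toℕ (⊖ g))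
    classify g with g ∈? J
    ... | yes g∈J = inj₁ g∈J
    ... | no  g∉J with ℕ.<-cmp (toℕ g) (toℕ (⊖ g))
    ...   | tri< g<⊖g _ _ = inj₂ (g∉J , inj₁ (g∉J , g<⊖g))
    ...   | tri≈ _ g≡⊖g _ = inj₂ (g∉J , inj₂ (inj₂ g≡⊖g))
    ...   | tri> _ _ ⊖g<g = inj₂ (g∉J , inj₂ (inj₁ (⊖-∉ g∉J , ⊖g<⊖⊖g)))
      where
      ⊖g<⊖⊖g : toℕ (⊖ g) < toℕ (⊖ (⊖ g))
      ⊖g<⊖⊖g = subst (λ z → toℕ (⊖ g) < toℕ z) (sym (⁻¹-involutive g)) ⊖g<g

    count±-reps++strictReps : ∀ g → count± g (reps ++ strictReps) ≡ 2 * 𝟙∁ J g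
    count±-reps++strictReps g rewrite count±-++ g reps strictReps with classify g
    ... | inj₁ g∈J rewrite 𝟙∁-∈ {J = J} g∈J =
      cong₂ _+_ (proj₁ (count±-∈ g∈J)) (proj₂ (count±-∈ g∈J))
    ... | inj₂ (g∉J , inj₁ sg) rewrite 𝟙∁-∉ {J = J} g∉J =
      cong₂ _+_ (proj₁ (count±-strictRep sg)) (proj₂ (count±-strictRep sg))
    ... | inj₂ (g∉J , inj₂ (inj₁ s⊖g)) rewrite 𝟙∁-∉ {J = J} g∉J =
      cong₂ _+_ (trans (sym (count±-⊖ g reps)) (proj₁ (count±-strictRep s⊖g)))
                (trans (sym (count±-⊖ g strictReps)) (proj₂ (count±-strictRep s⊖g)))
    ... | inj₂ (g∉J , inj₂ (inj₂ g≡⊖g)) rewrite 𝟙∁-∉ {J = J} g∉J =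
      cong₂ _+_ (proj₁ (count±-selfInverse g∉J g≡⊖g)) (proj₂ (count±-selfInverse g∉J g≡⊖g))

    count±-strictReps : (∀ {x} → x ∉ J → toℕ x ≢ toℕ (⊖ x)) → ∀ g → count± g strictReps ≡ 𝟙∁ J g
    count±-strictReps noSelfInverse g with classify g
    ... | inj₁ g∈J = trans (proj₂ (count±-∈ g∈J)) (sym (𝟙∁-∈ g∈J))
    ... | inj₂ (g∉J , inj₁ sg) = trans (proj₂ (count±-strictRep sg)) (sym (𝟙∁-∉ g∉J))
    ... | inj₂ (g∉J , inj₂ (inj₁ s⊖g)) =
      trans (sym (count±-⊖ g strictReps)) (trans (proj₂ (count±-strictRep s⊖g)) (sym (𝟙∁-∉ g∉J)))
    ... | inj₂ (g∉J , inj₂ (inj₂ g≡⊖g)) = contradiction g≡⊖g (noSelfInverse g∉J)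

    all-reps : All Rep reps
    all-reps = Allₚ.all-filter rep? (allFin v)

    all-strictReps : All StrictRep strictReps
    all-strictReps = Allₚ.all-filter strictRep? (allFin v)

    nonCancelling-strictReps : ∀ {x y} → StrictRep x → StrictRep y → NonCancelling x y
    nonCancelling-strictReps sx sy = nonCancelling-strictRep-rep sx (strictRep⇒rep sy)

    cyclic-strictReps : CyclicallyLinked NonCancelling strictReps
    cyclic-strictReps =
      linked-on (λ sx sy _ → nonCancelling-strictReps sx sy) all-strictReps (Uniqueₚ.filter⁺ strictRep? (Uniqueₚ.allFin⁺ v)) ,
      connected-last-head nonCancelling-strictReps all-strictReps all-strictReps

    cyclic-++ : ∀ xs ys → All Rep xs → Unique xs → All StrictRep ys → Linked NonCancelling ys →
                2 ≤ length (xs ++ ys) → CyclicallyLinked NonCancelling (xs ++ ys)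
    cyclic-++ (x ∷ [])     [] _ _ _ _ (s≤s ())
    cyclic-++ (x ∷ y ∷ zs) [] rxs unique@(x≢yzs ∷ _) _ _ _ =
      subst (CyclicallyLinked NonCancelling) (sym (++-identityʳ (x ∷ y ∷ zs)))
        (linked-on nonCancelling-reps rxs unique , wrap)
      where
      wrap : Connected NonCancelling (last (y ∷ zs)) (just x)
      wrap = connected-last-head {Q = _≡ x} (λ (rz , x≢z) → λ { refl → nonCancelling-reps rz (All.head rxs) (≢-sym x≢z) })
                                 (All.zip (All.tail rxs , x≢yzs)) (refl ∷ [])
    cyclic-++ xs (s ∷ ss) rxs unique sys lys _ =
      ++⁺ (linked-on nonCancelling-reps rxs unique)
          (connected-last-head (λ rx sy → nonCancelling-sym (nonCancelling-strictRep-rep sy rx)) rxs sys) lys ,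
      subst (λ z → Connected NonCancelling z (head (xs ++ s ∷ ss))) (sym (last-++ xs ss))
        (connected-last-head nonCancelling-strictRep-rep sys (Allₚ.++⁺ rxs (All.map strictRep⇒rep sys)))

    cyclic-reps++strictReps : 2 ≤ length (reps ++ strictReps) → CyclicallyLinked NonCancelling (reps ++ strictReps)
    cyclic-reps++strictReps = cyclic-++ reps strictReps all-reps (Uniqueₚ.filter⁺ rep? (Uniqueₚ.allFin⁺ v))
      all-strictReps (proj₁ cyclic-strictReps)

  BalancedCycle : Subset v → ℕ → List (Fin v) → Set
  BalancedCycle J lam c = CyclicallyLinked NonCancelling c × (∀ g → count± g c ≡ lam * 𝟙∁ J g)

  balancedCycle⇒NH : ∀ {J lam c} m → BalancedCycle J lam c → (len : length c ≡ suc (suc m) * 2) →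
                     Σ (PArray v (suc (suc m)) (suc (suc m))) (IsNH G J lam (suc (suc m)) (suc (suc m)) 2 2)
  balancedCycle⇒NH {J} {lam} {c} m (cyc@(linked , _) , mult) len = array , record
    { rowFill  = ListsPair-length ∘ row
    ; colFill  = ListsPair-length ∘ column
    ; mult∉J   = λ g g∉J → trans (count-pmList g) (trans (cong (lam *_) (𝟙∁-∉ g∉J)) (ℕ.*-identityʳ lam))
    ; mult∈J   = λ g g∈J → trans (count-pmList g) (trans (cong (lam *_) (𝟙∁-∈ g∈J)) (ℕ.*-zeroʳ lam))
    ; rowSum≢0 = λ i → sumG-ListsPair≢0 (pairUp-linked c len linked i) (row i)
    ; colSum≢0 = λ j → sumG-ListsPair≢0 (nonCancelling-sym (pairUp-cyclic c len cyc j)) (column j)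
    }
    where
    n : ℕ
    n = suc (suc m)
    a b : Fin n → Fin v
    a = proj₁ ∘ pairUp c len
    b = proj₂ ∘ pairUp c len

    array : PArray v n n
    array = twoDiagonals rotation a b

    row : ∀ i → ListsPair (a i) (b i) (rowEntries G array i)
    row = twoDiagonals-row rotation a b rotation-≢

    column : ∀ j → ListsPair (a j) (b (prev j)) (colEntries G array j)
    column = twoDiagonals-column rotation a b rotation-≢

    count-entries : ∀ g → count g (allEntries G array) ≡ count g c
    count-entries g = begin
      count g (concat (map (rowEntries G array) (allFin n)))  ≡⟨ cong (count g ∘ concat) (map-tabulate id (rowEntries G array)) ⟩
      count g (concat (tabulate (rowEntries G array)))        ≡⟨ count-concat-tabulate g (rowEntries G array) (pairList ∘ pairUp c len) (count-ListsPair g ∘ row) ⟩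
      count g (concat (tabulate (pairList ∘ pairUp c len)))   ≡⟨ cong (count g) (concat-pairUp {m = suc m} c len) ⟩
      count g c                                               ∎
      where open ≡-Reasoning

    count-pmList : ∀ g → count g (pmList G array) ≡ lam * 𝟙∁ J g
    count-pmList g = begin
      count g (pmList G array)        ≡⟨ count-concatMap-± g (allEntries G array) ⟩
      count± g (allEntries G array)   ≡⟨ cong₂ _+_ (count-entries g) (count-entries (⊖ g)) ⟩
      count± g c                      ≡⟨ mult g ⟩
      lam * 𝟙∁ J g                    ∎
      where open ≡-Reasoning

  balancedCycle-exists : ∀ (J : Subset v) → IsSubgroup G J → ∀ lam → (HasInvolutionOutside G J → 2 ∣ lam) →
                         4 ≤ v ∸ ∣ J ∣ → Σ (List (Fin v)) (BalancedCycle J lam)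
  balancedCycle-exists J J≤G lam involution⇒2∣lam 4≤v∸t with 2 ∣? lam
  ... | yes (divides k refl) =
    concat (replicate k V) ,
    concat-replicate⁺ (cyclic-reps++strictReps 2≤|V|) k ,
    λ g → trans (count±-concat-replicate g k V)
                (trans (cong (k *_) (count±-reps++strictReps g)) (sym (ℕ.*-assoc k 2 _)))
    where
    open Representatives J J≤G
    V : List (Fin v)
    V = reps ++ strictReps
    2≤|V| : 2 ≤ length V
    2≤|V| = ℕ.≤-trans (s≤s (s≤s z≤n))
              (subst (4 ≤_) (sym (m+m≡2*n⇒m≡n (length-by-count± J 2 V count±-reps++strictReps))) 4≤v∸t)
  ... | no 2∤lam =
    concat (replicate lam strictReps) ,
    concat-replicate⁺ cyclic-strictReps lam ,
    λ g → trans (count±-concat-replicate g lam strictReps) (cong (lam *_) (count±-strictReps noSelfInverse g))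
    where
    open Representatives J J≤G
    noSelfInverse : ∀ {x} → x ∉ J → toℕ x ≢ toℕ (⊖ x)
    noSelfInverse {x} x∉J x≡⊖x = 2∤lam (involution⇒2∣lam (x , x∉J , x≢0 , x⊕x≡0))
      where
      x⊕x≡0 : x ⊕ x ≡ 0g
      x⊕x≡0 = trans (cong (x ⊕_) (toℕ-injective x≡⊖x)) (inverseʳ x)
      x≢0 : x ≢ 0g
      x≢0 x≡0 = x∉J (subst (_∈ J) (sym x≡0) (IsSubgroup.0∈ J≤G))

open WithGroup

proposition6p6 : (v t lam n : ℕ) (G : FinGroup v) (J : Subset v) → IsSubgroup G J → ∣ J ∣ ≡ t
    → 1 ≤ lam → 2 ≤ n → t ≤ v → lam * (v ∸ t) ≡ 4 * n → t ∣ v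
    → (HasInvolutionOutside G J → 2 ∣ lam) → 4 ≤ v ∸ t
    → Σ (PArray v n n) (λ A → IsNH G J lam n n 2 2 A)
proposition6p6 v _ lam _ G J J≤G refl _ (s≤s (s≤s {n = m} _)) _ lam[v∸t]≡4n _ involution⇒2∣lam 4≤v∸t
  with c , balanced@(_ , mult) ← balancedCycle-exists G J J≤G lam involution⇒2∣lam 4≤v∸t =
  balancedCycle⇒NH G m balanced (m+m≡4*n⇒m≡n*2 (trans (length-by-count± G J lam c mult) lam[v∸t]≡4n))
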